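{- Let $t\ge2$ be an integer, let $G$ be a $3$-connected graph, and let $D\subseteq E(G)$ with $|D|\ge 3t-3$. Then there exists $D'\subseteq D$ with $|D'|=t$ such that $G-D'$ is connected. -}

module Defs where

open import Data.Nat using (ℕ; _<_)
open import Data.Fin using (Fin; toℕ)
open import Data.Fin.Properties using () renaming (_≟_ to _≟ᶠ_)
open import Data.Fin.Subset using (Subset; _∉_; ⊥; ∣_∣)
open import Data.Product using (_×_; _,_; proj₁; proj₂)
open import Data.Product.Properties using (≡-dec)
open import Data.Sum using (_⊎_)
open import Data.List using (List; filter)
import Data.List.Membership.Propositional as LM
import Data.List.Membership.DecPropositional as DM
open import Data.List.Relation.Unary.All using (All)
open import Data.List.Relation.Unary.Unique.Propositional using (Unique)
open import Relation.Binary.PropositionalEquality using (_≡_)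
open import Relation.Nullary.Decidable using (¬?)

-- An edge on vertex set Fin n, stored canonically as (u , v) with u < v.
Edge : ℕ → Set
Edge n = Fin n × Fin n

record Graph (n : ℕ) : Set where
  constructor graph
  field
    E : List (Edge n)
open Graph public

-- Simple graph: no loops, every edge stored as (u , v) with u < v,
-- and no edge listed twice (so no parallel edges).
IsSimple : ∀ {n} → Graph n → Set
IsSimple G = Unique (E G) × All (λ e → toℕ (proj₁ e) < toℕ (proj₂ e)) (E G)

Joins : ∀ {n} → Edge n → Fin n → Fin n → Set
Joins e u v = (e ≡ (u , v)) ⊎ (e ≡ (v , u))

data Walk {n : ℕ} (G : Graph n) (X : Subset n) : Fin n → Fin n → Set where
  stop : ∀ {u} → u ∉ X → Walk G X u u
  step : ∀ {u v w} (e : Edge n) → u ∉ X → e LM.∈ E G → Joins e u v →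
         Walk G X v w → Walk G X u w

ConnectedAvoiding : ∀ {n} → Graph n → Subset n → Set
ConnectedAvoiding {n} G X = (u v : Fin n) → u ∉ X → v ∉ X → Walk G X u v

Connected : ∀ {n} → Graph n → Set
Connected G = ConnectedAvoiding G ⊥

-- k-connected (Diestel): more than k vertices, and G - X connected
-- for every vertex set X with |X| < k.
KConnected : ℕ → ∀ {n} → Graph n → Set
KConnected k {n} G = (k < n) × ((X : Subset n) → ∣ X ∣ < k → ConnectedAvoiding G X)

_-ᴱ_ : ∀ {n} → Graph n → List (Edge n) → Graph n
_-ᴱ_ {n} G D = graph (filter (λ e → ¬? (e ∈? D)) (E G))
  where open DM (≡-dec (_≟ᶠ_ {n}) (_≟ᶠ_ {n})) using (_∈?_)

-- Let c be the number of components of G − D. Contracting them turns G into a connected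
-- multigraph on c vertices whose edges are those of D. Each component sends at least three
-- edges of D to the others: if two edges i₁o₁ and i₂o₂ were all, then, as G has more than
-- three vertices, two of their endpoints would separate G. Hence 3c ≤ 2|D| when c ≥ 2.
-- A spanning forest of the contracted multigraph uses at most c − 1 edges of D, and all
-- remaining edges of D can be deleted together without disconnecting G; there are at least
-- |D| − c + 1 ≥ |D|/3 + 1 ≥ t of them. Components and forest are computed by Kruskal's
-- algorithm, run first on the edges of G − D and then on D.
module Submission where

open import Defs
open import Algebra.Definitions using (IdempotentFun)
open import Data.Bool.Base using (true; false; if_then_else_)
open import Data.Empty using (⊥; ⊥-elim)
open import Data.Fin using (Fin; zero; suc; fromℕ<)
open import Data.Fin.Properties using (_≟_; any?)
open import Data.Fin.Subset using (Subset; ⁅_⁆; _∪_; ∣_∣; ⊤; inside; outside)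
  renaming (⊥ to ∅; _∈_ to _∈ₛ_; _∉_ to _∉ₛ_; _⊆_ to _⊆ₛ_)
open import Data.Fin.Subset.Properties
  using (∉⊥; ∣⊥∣≡0; ∣⊤∣≡n; ∣⁅x⁆∣≡1; x∈⁅x⁆; x≢y⇒x∉⁅y⁆; x∉⁅y⁆⇒x≢y; x∈p∪q⁺; x∈p∪q⁻; p⊆q⇒∣p∣≤∣q∣)
  renaming (_∈?_ to _∈ₛ?_)
open import Data.List using (List; []; _∷_; length; filter; take)
open import Data.List.Properties using (length-take)
open import Data.List.Membership.Propositional using (_∈_; _∉_)
open import Data.List.Membership.Propositional.Properties using (∈-filter⁺; ∈-filter⁻)
import Data.List.Membership.DecPropositional as DecMembership
open import Data.List.Relation.Unary.Any using (here; there)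
open import Data.List.Relation.Unary.All using (All; []; _∷_)
import Data.List.Relation.Unary.All as All
open import Data.List.Relation.Unary.All.Properties using (all-filter)
open import Data.List.Relation.Unary.Unique.Propositional using (Unique; _∷_)
open import Data.List.Relation.Unary.Unique.Propositional.Properties using (Unique[x∷xs]⇒x∉xs)
open import Data.List.Relation.Binary.Disjoint.Propositional using (Disjoint)
open import Data.List.Relation.Binary.Sublist.Propositional using (_⊆_; []; _∷_; _∷ʳ_; ⊆-trans; lookup)
open import Data.List.Relation.Binary.Sublist.Propositional.Properties using (take-⊆)
open import Data.List.Relation.Ternary.Interleaving using ([]; swap)
open import Data.List.Relation.Ternary.Interleaving.Propositional using (Interleaving; consˡ; consʳ)
open import Data.List.Relation.Ternary.Interleaving.Properties using (interleave-length)
open import Data.Nat using (ℕ; zero; suc; _+_; _*_; _∸_; _≤_; _<_; z≤n; s≤s; _≤?_)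
open import Data.Nat.Properties
  using ( ≤-refl; ≤-trans; ≤-reflexive; ≤-pred; <⇒≱; ≰⇒>; n≤1+n; n<1⇒n≡0; m<m+n; m≤n⇒m⊓n≡m
        ; m≤n+m∸n; m+n≤o⇒m≤o∸n; +-suc; +-comm; +-assoc; *-suc; *-distribˡ-+
        ; +-mono-≤; +-monoˡ-≤; +-monoʳ-≤; *-monoʳ-≤; +-cancelˡ-≤; *-cancelˡ-≤; module ≤-Reasoning
        ; +-0-commutativeMonoid; +-*-semiring)
open import Algebra.Properties.CommutativeMonoid.Sum +-0-commutativeMonoid
  using (sum-syntax; ∑-distrib-+; sum-cong-≗; sum-replicate-zero)
open import Algebra.Properties.Semiring.Sum +-*-semiring using (*-distribˡ-sum)
open import Data.Product using (_×_; _,_; proj₁; proj₂; ∃; ∃-syntax)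
open import Data.Product.Properties using (≡-dec)
open import Data.Sum using (_⊎_; inj₁; inj₂; [_,_])
open import Data.Vec.Base using ([]; _∷_)
open import Function using (_∘_; id)
open import Relation.Nullary using (Dec; yes; no; does; ¬_; contradiction)
open import Relation.Nullary.Decidable using (¬?; _×-dec_; _⊎-dec_; decidable-stable)
open import Relation.Unary using (Pred; Decidable)
open import Relation.Binary.PropositionalEquality hiding ([_])

𝟙 : ∀ {p} {P : Set p} → Dec P → ℕ
𝟙 d = if does d then 1 else 0

𝟙-mono-≤ : ∀ {p q} {P : Set p} {Q : Set q} → (P → Q) → (p : Dec P) (q : Dec Q) → 𝟙 p ≤ 𝟙 q
𝟙-mono-≤ P⇒Q (yes p) (no ¬q) = contradiction (P⇒Q p) ¬q
𝟙-mono-≤ P⇒Q (yes _) (yes _) = ≤-refl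
𝟙-mono-≤ P⇒Q (no _) _ = z≤n

module _ {p q r} {P : Set p} {Q : Set q} {R : Set r} where

  𝟙-⊎-≤ : (P → Q ⊎ R) → (p : Dec P) (q : Dec Q) (r : Dec R) → 𝟙 p ≤ 𝟙 q + 𝟙 r
  𝟙-⊎-≤ P⇒Q⊎R (yes p) (no ¬q) (no ¬r) = contradiction (P⇒Q⊎R p) [ ¬q , ¬r ]
  𝟙-⊎-≤ P⇒Q⊎R (yes _) (yes _) _ = s≤s z≤n
  𝟙-⊎-≤ P⇒Q⊎R (yes _) (no _) (yes _) = s≤s z≤n
  𝟙-⊎-≤ P⇒Q⊎R (no _) _ _ = z≤n

  𝟙-disjoint-⊎ : (P → Q ⊎ R) → (Q → P) → (R → P) → (Q → ¬ R) →
                 (p : Dec P) (q : Dec Q) (r : Dec R) → 𝟙 p ≡ 𝟙 q + 𝟙 r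
  𝟙-disjoint-⊎ P⇒Q⊎R Q⇒P R⇒P Q⇒¬R (yes p) (no ¬q) (no ¬r) = contradiction (P⇒Q⊎R p) [ ¬q , ¬r ]
  𝟙-disjoint-⊎ P⇒Q⊎R Q⇒P R⇒P Q⇒¬R (yes _) (yes q) (yes r) = contradiction r (Q⇒¬R q)
  𝟙-disjoint-⊎ P⇒Q⊎R Q⇒P R⇒P Q⇒¬R (yes _) (yes _) (no _) = refl
  𝟙-disjoint-⊎ P⇒Q⊎R Q⇒P R⇒P Q⇒¬R (yes _) (no _) (yes _) = refl
  𝟙-disjoint-⊎ P⇒Q⊎R Q⇒P R⇒P Q⇒¬R (no ¬p) (yes q) _ = contradiction (Q⇒P q) ¬p
  𝟙-disjoint-⊎ P⇒Q⊎R Q⇒P R⇒P Q⇒¬R (no ¬p) (no _) (yes r) = contradiction (R⇒P r) ¬p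
  𝟙-disjoint-⊎ P⇒Q⊎R Q⇒P R⇒P Q⇒¬R (no _) (no _) (no _) = refl

∑-mono-≤ : ∀ {n} {f g : Fin n → ℕ} → (∀ i → f i ≤ g i) → ∑[ i < n ] f i ≤ ∑[ i < n ] g i
∑-mono-≤ {zero} f≤g = z≤n
∑-mono-≤ {suc n} f≤g = +-mono-≤ (f≤g zero) (∑-mono-≤ (f≤g ∘ suc))

∑-δ : ∀ {n} (a : Fin n) → ∑[ x < n ] 𝟙 (a ≟ x) ≡ 1
∑-δ {suc n} zero = cong suc (sum-replicate-zero n)
∑-δ {suc n} (suc a) = ∑-δ a

∣p∪q∣≤∣p∣+∣q∣ : ∀ {n} (p q : Subset n) → ∣ p ∪ q ∣ ≤ ∣ p ∣ + ∣ q ∣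
∣p∪q∣≤∣p∣+∣q∣ [] [] = z≤n
∣p∪q∣≤∣p∣+∣q∣ (outside ∷ p) (outside ∷ q) = ∣p∪q∣≤∣p∣+∣q∣ p q
∣p∪q∣≤∣p∣+∣q∣ (outside ∷ p) (inside ∷ q) =
  ≤-trans (s≤s (∣p∪q∣≤∣p∣+∣q∣ p q)) (≤-reflexive (sym (+-suc ∣ p ∣ ∣ q ∣)))
∣p∪q∣≤∣p∣+∣q∣ (inside ∷ p) (outside ∷ q) = s≤s (∣p∪q∣≤∣p∣+∣q∣ p q)
∣p∪q∣≤∣p∣+∣q∣ (inside ∷ p) (inside ∷ q) =
  s≤s (≤-trans (∣p∪q∣≤∣p∣+∣q∣ p q) (+-monoʳ-≤ ∣ p ∣ (n≤1+n ∣ q ∣)))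

module _ {n : ℕ} where

  ∣⁅x⁆∪⁅y⁆∣≤2 : ∀ (x y : Fin n) → ∣ ⁅ x ⁆ ∪ ⁅ y ⁆ ∣ ≤ 2
  ∣⁅x⁆∪⁅y⁆∣≤2 x y =
    ≤-trans (∣p∪q∣≤∣p∣+∣q∣ ⁅ x ⁆ ⁅ y ⁆) (≤-reflexive (cong₂ _+_ (∣⁅x⁆∣≡1 x) (∣⁅x⁆∣≡1 y)))

  x∈⁅x⁆∪⁅y⁆ : ∀ (x y : Fin n) → x ∈ₛ ⁅ x ⁆ ∪ ⁅ y ⁆
  x∈⁅x⁆∪⁅y⁆ x y = x∈p∪q⁺ (inj₁ (x∈⁅x⁆ x))

  y∈⁅x⁆∪⁅y⁆ : ∀ (x y : Fin n) → y ∈ₛ ⁅ x ⁆ ∪ ⁅ y ⁆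
  y∈⁅x⁆∪⁅y⁆ x y = x∈p∪q⁺ (inj₂ (x∈⁅x⁆ y))

  x∉⁅y⁆∪⁅z⁆ : ∀ {x y z : Fin n} → x ≢ y → x ≢ z → x ∉ₛ ⁅ y ⁆ ∪ ⁅ z ⁆
  x∉⁅y⁆∪⁅z⁆ {y = y} {z} x≢y x≢z x∈ = [ x≢y⇒x∉⁅y⁆ x≢y , x≢y⇒x∉⁅y⁆ x≢z ] (x∈p∪q⁻ ⁅ y ⁆ ⁅ z ⁆ x∈)

  ∣p∣<n⇒∃∉ : ∀ {p : Subset n} → ∣ p ∣ < n → ∃ λ x → x ∉ₛ p
  ∣p∣<n⇒∃∉ {p} ∣p∣<n with any? (λ x → ¬? (x ∈ₛ? p))
  ... | yes x∉p = x∉p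
  ... | no ∄ = contradiction (subst (_≤ ∣ p ∣) (∣⊤∣≡n n) (p⊆q⇒∣p∣≤∣q∣ ⊤⊆p)) (<⇒≱ ∣p∣<n)
    where
    ⊤⊆p : ⊤ ⊆ₛ p
    ⊤⊆p {x} _ = decidable-stable (x ∈ₛ? p) (λ x∉p → ∄ (x , x∉p))

  3<n⇒∃≢ : 3 < n → (a b c : Fin n) → ∃ λ w → w ≢ a × w ≢ b × w ≢ c
  3<n⇒∃≢ 3<n a b c with ∣p∣<n⇒∃∉ {(⁅ a ⁆ ∪ ⁅ b ⁆) ∪ ⁅ c ⁆} (≤-trans (s≤s ∣abc∣≤3) 3<n)
    where
    ∣abc∣≤3 : ∣ (⁅ a ⁆ ∪ ⁅ b ⁆) ∪ ⁅ c ⁆ ∣ ≤ 3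
    ∣abc∣≤3 = ≤-trans (∣p∪q∣≤∣p∣+∣q∣ (⁅ a ⁆ ∪ ⁅ b ⁆) ⁅ c ⁆)
                      (+-mono-≤ (∣⁅x⁆∪⁅y⁆∣≤2 a b) (≤-reflexive (∣⁅x⁆∣≡1 c)))
  ... | w , w∉ =
    w , x∉⁅y⁆⇒x≢y (w∉ab ∘ inj₁) , x∉⁅y⁆⇒x≢y (w∉ab ∘ inj₂) , x∉⁅y⁆⇒x≢y (w∉ ∘ x∈p∪q⁺ ∘ inj₂)
    where
    w∉ab : ¬ (w ∈ₛ ⁅ a ⁆ ⊎ w ∈ₛ ⁅ b ⁆)
    w∉ab = w∉ ∘ x∈p∪q⁺ ∘ inj₁ ∘ x∈p∪q⁺

-- Walks and edge boundaries

module _ {n} {G : Graph n} {X : Subset n} where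

  _++ʷ_ : ∀ {u v w} → Walk G X u v → Walk G X v w → Walk G X u w
  stop _ ++ʷ q = q
  step e u∉X e∈G j p ++ʷ q = step e u∉X e∈G j (p ++ʷ q)

  source∉ : ∀ {u v} → Walk G X u v → u ∉ₛ X
  source∉ (stop u∉X) = u∉X
  source∉ (step _ u∉X _ _ _) = u∉X

kconnected⇒connected : ∀ {k n} {G : Graph n} → KConnected (suc k) G → Connected G
kconnected⇒connected {k} {n} κ = proj₂ κ ∅ (subst (_< suc k) (sym (∣⊥∣≡0 n)) (s≤s z≤n))

module _ {n ℓ} (S : Pred (Fin n) ℓ) where

  CoversBoundary : Graph n → Subset n → Set ℓ
  CoversBoundary G X = ∀ {e x y} → e ∈ E G → Joins e x y → S x → ¬ S y → x ∈ₛ X ⊎ y ∈ₛ X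

  Crosses : Pred (Edge n) ℓ
  Crosses (u , v) = (S u × ¬ S v) ⊎ (¬ S u × S v)

  record Orientation (e : Edge n) : Set ℓ where
    field
      inner outer : Fin n
      inner∈S : S inner
      outer∉S : ¬ S outer
      oriented : ∀ {x y} → Joins e x y → S x → ¬ S y → x ≡ inner × y ≡ outer

module _ {n ℓ} {S : Pred (Fin n) ℓ} where

  crosses? : Decidable S → Decidable (Crosses S)
  crosses? S? (u , v) = (S? u ×-dec ¬? (S? v)) ⊎-dec (¬? (S? u) ×-dec S? v)

  joins-crosses : ∀ {e x y} → Joins e x y → S x → ¬ S y → Crosses S e
  joins-crosses (inj₁ refl) Sx ¬Sy = inj₁ (Sx , ¬Sy)
  joins-crosses (inj₂ refl) Sx ¬Sy = inj₂ (¬Sy , Sx)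

  orientation : ∀ {e} → Crosses S e → Orientation S e
  orientation {u , v} (inj₁ (Su , ¬Sv)) = record
    { inner = u ; outer = v ; inner∈S = Su ; outer∉S = ¬Sv ; oriented = oriented }
    where
    oriented : ∀ {x y} → Joins (u , v) x y → S x → ¬ S y → x ≡ u × y ≡ v
    oriented (inj₁ refl) _ _ = refl , refl
    oriented (inj₂ refl) Sv _ = contradiction Sv ¬Sv
  orientation {u , v} (inj₂ (¬Su , Sv)) = record
    { inner = v ; outer = u ; inner∈S = Sv ; outer∉S = ¬Su ; oriented = oriented }
    where
    oriented : ∀ {x y} → Joins (u , v) x y → S x → ¬ S y → x ≡ v × y ≡ u
    oriented (inj₁ refl) Su _ = contradiction Su ¬Su
    oriented (inj₂ refl) _ _ = refl , refl

  cover-blocks-walk : ∀ {G : Graph n} {X u v} → Decidable S → CoversBoundary S G X →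
                      Walk G X u v → S u → ¬ S v → ⊥
  cover-blocks-walk S? cover (stop _) Su ¬Sv = ¬Sv Su
  cover-blocks-walk S? cover (step {v = w} e u∉X e∈G j p) Su ¬Sv with S? w
  ... | yes Sw = cover-blocks-walk S? cover p Sw ¬Sv
  ... | no ¬Sw = [ u∉X , source∉ p ] (cover e∈G j Su ¬Sw)

module ThreeConnected {n ℓ} {G : Graph n} (κ : KConnected 3 G)
                      {S : Pred (Fin n) ℓ} (S? : Decidable S) where

  BoundaryWithin : Fin n → Fin n → Fin n → Fin n → Set ℓ
  BoundaryWithin i₁ o₁ i₂ o₂ = ∀ {e x y} → e ∈ E G → Joins e x y → S x → ¬ S y →
                               (x ≡ i₁ × y ≡ o₁) ⊎ (x ≡ i₂ × y ≡ o₂)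

  private
    S≢¬S : ∀ {x y} → S x → ¬ S y → x ≢ y
    S≢¬S Sx ¬Sy refl = ¬Sy Sx

  ¬CoversBoundary : ∀ {a b u v} → CoversBoundary S G (⁅ a ⁆ ∪ ⁅ b ⁆) →
                    S u → u ≢ a → u ≢ b → ¬ S v → v ≢ a → v ≢ b → ⊥
  ¬CoversBoundary {a} {b} {u} {v} cover Su u≢a u≢b ¬Sv v≢a v≢b = cover-blocks-walk S? cover walk Su ¬Sv
    where
    walk : Walk G (⁅ a ⁆ ∪ ⁅ b ⁆) u v
    walk = proj₂ κ _ (s≤s (∣⁅x⁆∪⁅y⁆∣≤2 a b)) u v (x∉⁅y⁆∪⁅z⁆ u≢a u≢b) (x∉⁅y⁆∪⁅z⁆ v≢a v≢b)

  module _ {i₁ o₁ i₂ o₂} (Si₁ : S i₁) (¬So₁ : ¬ S o₁) (Si₂ : S i₂) (¬So₂ : ¬ S o₂)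
           (within : BoundaryWithin i₁ o₁ i₂ o₂) where

    private
      inner-cover : CoversBoundary S G (⁅ i₁ ⁆ ∪ ⁅ i₂ ⁆)
      inner-cover e∈G j Sx ¬Sy with within e∈G j Sx ¬Sy
      ... | inj₁ (refl , _) = inj₁ (x∈⁅x⁆∪⁅y⁆ _ _)
      ... | inj₂ (refl , _) = inj₁ (y∈⁅x⁆∪⁅y⁆ _ _)

      outer-cover : CoversBoundary S G (⁅ o₁ ⁆ ∪ ⁅ o₂ ⁆)
      outer-cover e∈G j Sx ¬Sy with within e∈G j Sx ¬Sy
      ... | inj₁ (_ , refl) = inj₂ (x∈⁅x⁆∪⁅y⁆ _ _)
      ... | inj₂ (_ , refl) = inj₂ (y∈⁅x⁆∪⁅y⁆ _ _)

      crossed-cover : CoversBoundary S G (⁅ i₁ ⁆ ∪ ⁅ o₂ ⁆)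
      crossed-cover e∈G j Sx ¬Sy with within e∈G j Sx ¬Sy
      ... | inj₁ (refl , _) = inj₁ (x∈⁅x⁆∪⁅y⁆ _ _)
      ... | inj₂ (_ , refl) = inj₂ (y∈⁅x⁆∪⁅y⁆ _ _)

      ¬fifth-vertex : ∀ {w} → w ≢ i₁ → w ≢ i₂ → w ≢ o₁ → w ≢ o₂ → ⊥
      ¬fifth-vertex {w} w≢i₁ w≢i₂ w≢o₁ w≢o₂ with S? w
      ... | yes Sw =
        ¬CoversBoundary inner-cover Sw w≢i₁ w≢i₂ ¬So₁ (S≢¬S Si₁ ¬So₁ ∘ sym) (S≢¬S Si₂ ¬So₁ ∘ sym)
      ... | no ¬Sw =
        ¬CoversBoundary outer-cover Si₁ (S≢¬S Si₁ ¬So₁) (S≢¬S Si₁ ¬So₂) ¬Sw w≢o₁ w≢o₂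

    -- If i₁ ≢ i₂ and o₁ ≢ o₂, then {i₁, o₂} separates i₂ from o₁. Otherwise the endpoints are
    -- at most three vertices, and a further vertex is cut off by {i₁, i₂} or by {o₁, o₂}.
    ¬BoundaryWithin : ⊥
    ¬BoundaryWithin with i₁ ≟ i₂ | o₁ ≟ o₂
    ... | yes refl | _ =
      let w , w≢i₁ , w≢o₁ , w≢o₂ = 3<n⇒∃≢ (proj₁ κ) i₁ o₁ o₂ in ¬fifth-vertex w≢i₁ w≢i₁ w≢o₁ w≢o₂
    ... | no _ | yes refl =
      let w , w≢i₁ , w≢i₂ , w≢o₁ = 3<n⇒∃≢ (proj₁ κ) i₁ i₂ o₁ in ¬fifth-vertex w≢i₁ w≢i₂ w≢o₁ w≢o₁
    ... | no i₁≢i₂ | no o₁≢o₂ =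
      ¬CoversBoundary crossed-cover Si₂ (i₁≢i₂ ∘ sym) (S≢¬S Si₂ ¬So₂) ¬So₁ (S≢¬S Si₁ ¬So₁ ∘ sym) o₁≢o₂

  boundary≥3 : ∀ {r s} (L : List (Edge n)) → All (Crosses S) L →
               (∀ {e x y} → e ∈ E G → Joins e x y → S x → ¬ S y → e ∈ L) →
               S r → ¬ S s → 3 ≤ length L
  boundary≥3 {r} {s} [] _ complete Sr ¬Ss = ⊥-elim (¬BoundaryWithin Sr ¬Ss Sr ¬Ss within)
    where
    within : BoundaryWithin r s r s
    within e∈G j Sx ¬Sy with complete e∈G j Sx ¬Sy
    ... | ()
  boundary≥3 (e ∷ []) (c ∷ []) complete _ _ =
    ⊥-elim (¬BoundaryWithin inner∈S outer∉S inner∈S outer∉S within)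
    where
    open Orientation (orientation {S = S} c)
    within : BoundaryWithin inner outer inner outer
    within e∈G j Sx ¬Sy with complete e∈G j Sx ¬Sy
    ... | here refl = inj₁ (oriented j Sx ¬Sy)
  boundary≥3 (e₁ ∷ e₂ ∷ []) (c₁ ∷ c₂ ∷ []) complete _ _ =
    ⊥-elim (¬BoundaryWithin (inner∈S O₁) (outer∉S O₁) (inner∈S O₂) (outer∉S O₂) within)
    where
    open Orientation
    O₁ : Orientation S e₁
    O₁ = orientation c₁
    O₂ : Orientation S e₂
    O₂ = orientation c₂
    within : BoundaryWithin (inner O₁) (outer O₁) (inner O₂) (outer O₂)
    within e∈G j Sx ¬Sy with complete e∈G j Sx ¬Sy
    ... | here refl = inj₁ (oriented O₁ j Sx ¬Sy)
    ... | there (here refl) = inj₂ (oriented O₂ j Sx ¬Sy)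
  boundary≥3 (_ ∷ _ ∷ _ ∷ _) _ _ _ _ = s≤s (s≤s (s≤s z≤n))

-- Vertex labellings

module _ {n : ℕ} where

  Internal : (Fin n → Fin n) → Edge n → Set
  Internal lab e = lab (proj₁ e) ≡ lab (proj₂ e)

  internal-joins : ∀ {lab e x y} → Internal lab e → Joins e x y → lab x ≡ lab y
  internal-joins int (inj₁ refl) = int
  internal-joins int (inj₂ refl) = sym int

  walk-preserves : ∀ {G : Graph n} {X lab u v} → (∀ {e} → e ∈ E G → Internal lab e) →
                   Walk G X u v → lab u ≡ lab v
  walk-preserves int (stop _) = refl
  walk-preserves int (step e _ e∈G j p) = trans (internal-joins (int e∈G) j) (walk-preserves int p)

  ClassesConnected : Graph n → (Fin n → Fin n) → Set
  ClassesConnected H lab = ∀ u v → lab u ≡ lab v → Walk H ∅ u v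

  id-classes-connected : ∀ {H} → ClassesConnected H id
  id-classes-connected {H} u v u≡v = subst (Walk H ∅ u) u≡v (stop ∉⊥)

  -- The classes of a labelling are its fibres; for an idempotent labelling the fixed points
  -- are one representative per class, so roots counts the classes.
  roots : (Fin n → Fin n) → ℕ
  roots lab = ∑[ x < n ] 𝟙 (lab x ≟ x)

  roots-positive : ∀ {lab} → IdempotentFun _≡_ lab → Fin n → 1 ≤ roots lab
  roots-positive {lab} idem z = begin
    1                         ≡⟨ ∑-δ (lab z) ⟨
    ∑[ x < n ] 𝟙 (lab z ≟ x)  ≤⟨ ∑-mono-≤ (λ x → 𝟙-mono-≤ root (lab z ≟ x) (lab x ≟ x)) ⟩
    roots lab                 ∎
    where
    open ≤-Reasoning
    root : ∀ {x} → lab z ≡ x → lab x ≡ x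
    root refl = idem z

  another-class : ∀ {lab} → 2 ≤ roots lab → ∀ r → ∃ λ s → lab s ≢ r
  another-class {lab} 2≤roots r with any? (λ s → ¬? (lab s ≟ r))
  ... | yes s = s
  ... | no ∄ = contradiction (≤-trans (∑-mono-≤ only-r) (≤-reflexive (∑-δ r))) (<⇒≱ 2≤roots)
    where
    only-r : ∀ x → 𝟙 (lab x ≟ x) ≤ 𝟙 (r ≟ x)
    only-r x = 𝟙-mono-≤ (trans (sym (decidable-stable (lab x ≟ r) (λ lx≢r → ∄ (x , lx≢r)))))
                        (lab x ≟ x) (r ≟ x)

  redirect : Fin n → Fin n → Fin n → Fin n
  redirect a b c = if does (c ≟ b) then a else c

  redirect-view : ∀ a b c → (c ≡ b × redirect a b c ≡ a) ⊎ (c ≢ b × redirect a b c ≡ c)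
  redirect-view a b c with c ≟ b
  ... | yes c≡b = inj₁ (c≡b , refl)
  ... | no c≢b = inj₂ (c≢b , refl)

  redirect-source : ∀ a b → redirect a b a ≡ a
  redirect-source a b with a ≟ b
  ... | yes _ = refl
  ... | no _ = refl

  redirect-target : ∀ a b → redirect a b b ≡ a
  redirect-target a b with b ≟ b
  ... | yes _ = refl
  ... | no b≢b = contradiction refl b≢b

  redirect-idempotent : ∀ a b c → redirect a b (redirect a b c) ≡ redirect a b c
  redirect-idempotent a b c with redirect-view a b c
  ... | inj₁ (_ , r≡a) = trans (cong (redirect a b) r≡a) (trans (redirect-source a b) (sym r≡a))
  ... | inj₂ (_ , r≡c) = cong (redirect a b) r≡c

  merge : (Fin n → Fin n) → Fin n → Fin n → Fin n → Fin n
  merge lab a b = redirect (lab a) (lab b) ∘ lab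

  merge-internal : ∀ lab a b → Internal (merge lab a b) (a , b)
  merge-internal lab a b = trans (redirect-source (lab a) (lab b)) (sym (redirect-target (lab a) (lab b)))

  merge-coarsens : ∀ lab a b {x y} → lab x ≡ lab y → merge lab a b x ≡ merge lab a b y
  merge-coarsens lab a b = cong (redirect (lab a) (lab b))

  merge-idempotent : ∀ {lab} a b → IdempotentFun _≡_ lab → IdempotentFun _≡_ (merge lab a b)
  merge-idempotent {lab} a b idem x =
    trans (cong (redirect (lab a) (lab b)) lab-fixes-merge) (redirect-idempotent (lab a) (lab b) (lab x))
    where
    lab-fixes-merge : lab (merge lab a b x) ≡ merge lab a b x
    lab-fixes-merge with redirect-view (lab a) (lab b) (lab x)
    ... | inj₁ (_ , m≡la) = trans (cong lab m≡la) (trans (idem a) (sym m≡la))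
    ... | inj₂ (_ , m≡lx) = trans (cong lab m≡lx) (trans (idem x) (sym m≡lx))

  module _ {lab : Fin n → Fin n} {a b : Fin n} where

    merge-connected : ∀ {H} → ClassesConnected H lab → (a , b) ∈ E H → ClassesConnected H (merge lab a b)
    merge-connected conn ab∈H u v eq
      with redirect-view (lab a) (lab b) (lab u) | redirect-view (lab a) (lab b) (lab v)
    ... | inj₁ (lu≡lb , _) | inj₁ (lv≡lb , _) = conn u v (trans lu≡lb (sym lv≡lb))
    ... | inj₁ (lu≡lb , mu≡la) | inj₂ (_ , mv≡lv) =
      conn u b lu≡lb ++ʷ step (a , b) ∉⊥ ab∈H (inj₂ refl) (conn a v (trans (sym mu≡la) (trans eq mv≡lv)))
    ... | inj₂ (_ , mu≡lu) | inj₁ (lv≡lb , mv≡la) =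
      conn u a (trans (sym mu≡lu) (trans eq mv≡la)) ++ʷ step (a , b) ∉⊥ ab∈H (inj₁ refl) (conn b v (sym lv≡lb))
    ... | inj₂ (_ , mu≡lu) | inj₂ (_ , mv≡lv) = conn u v (trans (sym mu≡lu) (trans eq mv≡lv))

    -- The roots of lab are the roots of merge lab a b together with lab b.
    roots-merge : IdempotentFun _≡_ lab → lab a ≢ lab b → roots lab ≡ suc (roots (merge lab a b))
    roots-merge idem la≢lb = begin
      roots lab                                               ≡⟨ sum-cong-≗ split ⟩
      ∑[ x < n ] (merged-root x + target x)                   ≡⟨ ∑-distrib-+ merged-root target ⟩
      roots (merge lab a b) + ∑[ x < n ] target x            ≡⟨ cong (roots (merge lab a b) +_) (∑-δ (lab b)) ⟩
      roots (merge lab a b) + 1                               ≡⟨ +-comm _ 1 ⟩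
      suc (roots (merge lab a b))                             ∎
      where
      open ≡-Reasoning
      merged-root target : Fin n → ℕ
      merged-root x = 𝟙 (merge lab a b x ≟ x)
      target x = 𝟙 (lab b ≟ x)
      root⇒merged-root⊎target : ∀ {x} → lab x ≡ x → merge lab a b x ≡ x ⊎ lab b ≡ x
      root⇒merged-root⊎target {x} lx≡x with redirect-view (lab a) (lab b) (lab x)
      ... | inj₁ (lx≡lb , _) = inj₂ (trans (sym lx≡lb) lx≡x)
      ... | inj₂ (_ , m≡lx) = inj₁ (trans m≡lx lx≡x)
      merged-root⇒root : ∀ {x} → merge lab a b x ≡ x → lab x ≡ x
      merged-root⇒root {x} m≡x with redirect-view (lab a) (lab b) (lab x)
      ... | inj₁ (lx≡lb , m≡la) = contradiction (trans (sym lx≡la) lx≡lb) la≢lb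
        where
        lx≡la : lab x ≡ lab a
        lx≡la = trans (cong lab (trans (sym m≡x) m≡la)) (idem a)
      ... | inj₂ (_ , m≡lx) = trans (sym m≡lx) m≡x
      target⇒root : ∀ {x} → lab b ≡ x → lab x ≡ x
      target⇒root refl = idem b
      merged-root⇒¬target : ∀ {x} → merge lab a b x ≡ x → lab b ≢ x
      merged-root⇒¬target m≡x refl = la≢lb (trans (sym m[lb]≡la) m≡x)
        where
        m[lb]≡la : merge lab a b (lab b) ≡ lab a
        m[lb]≡la = trans (cong (redirect (lab a) (lab b)) (idem b)) (redirect-target (lab a) (lab b))
      split : ∀ x → 𝟙 (lab x ≟ x) ≡ merged-root x + target x
      split x = 𝟙-disjoint-⊎ root⇒merged-root⊎target merged-root⇒root target⇒root merged-root⇒¬target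
                             (lab x ≟ x) (merge lab a b x ≟ x) (lab b ≟ x)

-- Kruskal's algorithm

module _ {a} {A : Set a} where

  interleaving⇒⊆ˡ : ∀ {l r xs : List A} → Interleaving l r xs → l ⊆ xs
  interleaving⇒⊆ˡ [] = []
  interleaving⇒⊆ˡ (consˡ sp) = refl ∷ interleaving⇒⊆ˡ sp
  interleaving⇒⊆ˡ (consʳ sp) = _ ∷ʳ interleaving⇒⊆ˡ sp

  interleaving⇒⊆ʳ : ∀ {l r xs : List A} → Interleaving l r xs → r ⊆ xs
  interleaving⇒⊆ʳ = interleaving⇒⊆ˡ ∘ swap

  interleaving-disjoint : ∀ {l r xs : List A} → Unique xs → Interleaving l r xs → Disjoint l r
  interleaving-disjoint u (consˡ sp) (here refl , x∈r) =
    Unique[x∷xs]⇒x∉xs u (lookup (interleaving⇒⊆ʳ sp) x∈r)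
  interleaving-disjoint (_ ∷ u) (consˡ sp) (there v∈l , v∈r) = interleaving-disjoint u sp (v∈l , v∈r)
  interleaving-disjoint u (consʳ sp) (x∈l , here refl) =
    Unique[x∷xs]⇒x∉xs u (lookup (interleaving⇒⊆ˡ sp) x∈l)
  interleaving-disjoint (_ ∷ u) (consʳ sp) (v∈l , there v∈r) = interleaving-disjoint u sp (v∈l , v∈r)

record Kruskal (n : ℕ) : Set where
  field
    tree rest : List (Edge n)
    label : Fin n → Fin n

kruskal : ∀ {n} → (Fin n → Fin n) → List (Edge n) → Kruskal n
kruskal lab [] = record { tree = [] ; rest = [] ; label = lab }
kruskal lab ((a , b) ∷ es) with lab a ≟ lab b
... | yes _ = let k = kruskal lab es in record k { rest = (a , b) ∷ Kruskal.rest k }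
... | no _ = let k = kruskal (merge lab a b) es in record k { tree = (a , b) ∷ Kruskal.tree k }

module _ {n : ℕ} where
  open Kruskal

  kruskal-interleaving : ∀ (lab : Fin n → Fin n) es →
                         Interleaving (tree (kruskal lab es)) (rest (kruskal lab es)) es
  kruskal-interleaving lab [] = []
  kruskal-interleaving lab ((a , b) ∷ es) with lab a ≟ lab b
  ... | yes _ = consʳ (kruskal-interleaving lab es)
  ... | no _ = consˡ (kruskal-interleaving (merge lab a b) es)

  kruskal-coarsens : ∀ (lab : Fin n → Fin n) es {x y} →
                     lab x ≡ lab y → label (kruskal lab es) x ≡ label (kruskal lab es) y
  kruskal-coarsens lab [] eq = eq
  kruskal-coarsens lab ((a , b) ∷ es) eq with lab a ≟ lab b
  ... | yes _ = kruskal-coarsens lab es eq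
  ... | no _ = kruskal-coarsens (merge lab a b) es (merge-coarsens lab a b eq)

  kruskal-internal : ∀ (lab : Fin n → Fin n) es → All (Internal (label (kruskal lab es))) es
  kruskal-internal lab [] = []
  kruskal-internal lab ((a , b) ∷ es) with lab a ≟ lab b
  ... | yes la≡lb = kruskal-coarsens lab es la≡lb ∷ kruskal-internal lab es
  ... | no _ = kruskal-coarsens (merge lab a b) es (merge-internal lab a b)
             ∷ kruskal-internal (merge lab a b) es

  kruskal-idempotent : ∀ {lab : Fin n → Fin n} es →
                       IdempotentFun _≡_ lab → IdempotentFun _≡_ (label (kruskal lab es))
  kruskal-idempotent [] idem = idem
  kruskal-idempotent {lab} ((a , b) ∷ es) idem with lab a ≟ lab b
  ... | yes _ = kruskal-idempotent es idem
  ... | no _ = kruskal-idempotent es (merge-idempotent a b idem)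

  kruskal-roots : ∀ {lab : Fin n → Fin n} es → IdempotentFun _≡_ lab →
                  roots lab ≡ length (tree (kruskal lab es)) + roots (label (kruskal lab es))
  kruskal-roots [] idem = refl
  kruskal-roots {lab} ((a , b) ∷ es) idem with lab a ≟ lab b
  ... | yes _ = kruskal-roots es idem
  ... | no la≢lb = trans (roots-merge idem la≢lb) (cong suc (kruskal-roots es (merge-idempotent a b idem)))

  kruskal-connected : ∀ {H} {lab : Fin n → Fin n} es → ClassesConnected H lab →
                      (∀ {e} → e ∈ tree (kruskal lab es) → e ∈ E H) →
                      ClassesConnected H (label (kruskal lab es))
  kruskal-connected [] conn _ = conn
  kruskal-connected {lab = lab} ((a , b) ∷ es) conn tree⊆H with lab a ≟ lab b
  ... | yes _ = kruskal-connected es conn tree⊆H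
  ... | no _ = kruskal-connected es (merge-connected conn (tree⊆H (here refl))) (tree⊆H ∘ there)

-- Counting boundary edges

module _ {n : ℕ} (lab : Fin n → Fin n) where

  InClass : Fin n → Pred (Fin n) _
  InClass r x = lab x ≡ r

  inClass? : ∀ r → Decidable (InClass r)
  inClass? r x = lab x ≟ r

  boundary : Fin n → List (Edge n) → List (Edge n)
  boundary r = filter (crosses? (inClass? r))

  crossings≤2 : ∀ e → ∑[ r < n ] 𝟙 (crosses? (inClass? r) e) ≤ 2
  crossings≤2 (u , v) = begin
    ∑[ r < n ] 𝟙 (crosses? (inClass? r) (u , v))         ≤⟨ ∑-mono-≤ crossing≤ends ⟩
    ∑[ r < n ] (𝟙 (lab u ≟ r) + 𝟙 (lab v ≟ r))           ≡⟨ ∑-distrib-+ (at u) (at v) ⟩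
    ∑[ r < n ] 𝟙 (lab u ≟ r) + ∑[ r < n ] 𝟙 (lab v ≟ r)  ≡⟨ cong₂ _+_ (∑-δ (lab u)) (∑-δ (lab v)) ⟩
    2                                                      ∎
    where
    open ≤-Reasoning
    endpoint : ∀ {r} → Crosses (InClass r) (u , v) → lab u ≡ r ⊎ lab v ≡ r
    endpoint (inj₁ (lu≡r , _)) = inj₁ lu≡r
    endpoint (inj₂ (_ , lv≡r)) = inj₂ lv≡r
    at : Fin n → Fin n → ℕ
    at x r = 𝟙 (lab x ≟ r)
    crossing≤ends : ∀ r → 𝟙 (crosses? (inClass? r) (u , v)) ≤ at u r + at v r
    crossing≤ends r = 𝟙-⊎-≤ endpoint (crosses? (inClass? r) (u , v)) (lab u ≟ r) (lab v ≟ r)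

  length-boundary-∷ : ∀ r e D →
                      length (boundary r (e ∷ D)) ≡ 𝟙 (crosses? (inClass? r) e) + length (boundary r D)
  length-boundary-∷ r e D with does (crosses? (inClass? r) e)
  ... | true = refl
  ... | false = refl

  ∑-boundary≤ : ∀ D → ∑[ r < n ] length (boundary r D) ≤ 2 * length D
  ∑-boundary≤ [] = ≤-reflexive (sum-replicate-zero n)
  ∑-boundary≤ (e ∷ D) = begin
    ∑[ r < n ] length (boundary r (e ∷ D))         ≡⟨ sum-cong-≗ (λ r → length-boundary-∷ r e D) ⟩
    ∑[ r < n ] (crossing r + size r)               ≡⟨ ∑-distrib-+ crossing size ⟩
    ∑[ r < n ] crossing r + ∑[ r < n ] size r      ≤⟨ +-mono-≤ (crossings≤2 e) (∑-boundary≤ D) ⟩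
    2 + 2 * length D                               ≡⟨ *-suc 2 (length D) ⟨
    2 * length (e ∷ D)                             ∎
    where
    open ≤-Reasoning
    crossing size : Fin n → ℕ
    crossing r = 𝟙 (crosses? (inClass? r) e)
    size r = length (boundary r D)

module _ {n} {G : Graph n} (κ : KConnected 3 G) {lab : Fin n → Fin n} {D : List (Edge n)}
         (internal : ∀ {e} → e ∈ E G → e ∉ D → Internal lab e) where
  open DecMembership (≡-dec (_≟_ {n}) (_≟_ {n})) using (_∈?_)

  boundary-of-class≥3 : ∀ {r s} → lab r ≡ r → lab s ≢ r → 3 ≤ length (boundary lab r D)
  boundary-of-class≥3 {r} lr≡r ls≢r =
    ThreeConnected.boundary≥3 κ (inClass? lab r) (boundary lab r D)
                              (all-filter (crosses? (inClass? lab r)) D) complete lr≡r ls≢r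
    where
    complete : ∀ {e x y} → e ∈ E G → Joins e x y → lab x ≡ r → lab y ≢ r → e ∈ boundary lab r D
    complete {e} e∈G j lx≡r ly≢r with e ∈? D
    ... | yes e∈D = ∈-filter⁺ (crosses? (inClass? lab r)) e∈D (joins-crosses j lx≡r ly≢r)
    ... | no e∉D = contradiction (trans (sym (internal-joins (internal e∈G e∉D) j)) lx≡r) ly≢r

  roots-bound : 2 ≤ roots lab → 3 * roots lab ≤ 2 * length D
  roots-bound 2≤roots = begin
    3 * roots lab                         ≡⟨ *-distribˡ-sum 3 (λ r → 𝟙 (lab r ≟ r)) ⟩
    ∑[ r < n ] (3 * 𝟙 (lab r ≟ r))        ≤⟨ ∑-mono-≤ three≤boundary ⟩
    ∑[ r < n ] length (boundary lab r D)  ≤⟨ ∑-boundary≤ lab D ⟩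
    2 * length D                          ∎
    where
    open ≤-Reasoning
    three≤boundary : ∀ r → 3 * 𝟙 (lab r ≟ r) ≤ length (boundary lab r D)
    three≤boundary r with lab r ≟ r
    ... | yes lr≡r = boundary-of-class≥3 lr≡r (proj₂ (another-class {lab = lab} 2≤roots r))
    ... | no _ = z≤n

rest-bound : ∀ {t d m f c} → 2 ≤ t → 3 * t ∸ 3 ≤ d → d ≡ m + f → m < c →
             (2 ≤ c → 3 * c ≤ 2 * d) → t ≤ f
rest-bound {t} {d} {m} {f} {c} 2≤t 3t∸3≤d refl m<c bound with 2 ≤? c
... | yes 2≤c = *-cancelˡ-≤ 3 (begin
  3 * t            ≤⟨ m≤n+m∸n (3 * t) 3 ⟩
  3 + (3 * t ∸ 3)  ≤⟨ +-monoʳ-≤ 3 3t∸3≤d ⟩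
  3 + (m + f)      ≡⟨ +-assoc 3 m f ⟨
  3 + m + f        ≤⟨ +-monoˡ-≤ f 3+m≤2f ⟩
  2 * f + f        ≡⟨ +-comm (2 * f) f ⟩
  3 * f            ∎)
  where
  open ≤-Reasoning
  3+m≤2f : 3 + m ≤ 2 * f
  3+m≤2f = +-cancelˡ-≤ (2 * m) (3 + m) (2 * f) (begin
    2 * m + (3 + m)  ≡⟨ +-comm (2 * m) (3 + m) ⟩
    3 + m + 2 * m    ≡⟨ +-assoc 3 m (2 * m) ⟩
    3 + 3 * m        ≡⟨ *-suc 3 m ⟨
    3 * suc m        ≤⟨ *-monoʳ-≤ 3 m<c ⟩
    3 * c            ≤⟨ bound 2≤c ⟩
    2 * (m + f)      ≡⟨ *-distribˡ-+ 2 m f ⟩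
    2 * m + 2 * f    ∎)
... | no 2≰c = begin
  t          ≤⟨ m+n≤o⇒m≤o∸n t t+3≤3t ⟩
  3 * t ∸ 3  ≤⟨ 3t∸3≤d ⟩
  m + f      ≡⟨ cong (_+ f) m≡0 ⟩
  f          ∎
  where
  open ≤-Reasoning
  m≡0 : m ≡ 0
  m≡0 = n<1⇒n≡0 (≤-trans m<c (≤-pred (≰⇒> 2≰c)))
  t+3≤3t : t + 3 ≤ 3 * t
  t+3≤3t = +-monoʳ-≤ t (≤-trans (s≤s (s≤s (s≤s z≤n))) (*-monoʳ-≤ 2 2≤t))

module _ {n} (G : Graph n) {D : List (Edge n)} where
  open DecMembership (≡-dec (_≟_ {n}) (_≟_ {n})) using (_∈?_)

  ∈-ᴱ⁺ : ∀ {e} → e ∈ E G → e ∉ D → e ∈ E (G -ᴱ D)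
  ∈-ᴱ⁺ = ∈-filter⁺ (λ e → ¬? (e ∈? D))

  ∈-ᴱ⁻ : ∀ {e} → e ∈ E (G -ᴱ D) → e ∈ E G × e ∉ D
  ∈-ᴱ⁻ = ∈-filter⁻ (λ e → ¬? (e ∈? D))

module SpanningForest {n} (G : Graph n) (D : List (Edge n)) where
  open DecMembership (≡-dec (_≟_ {n}) (_≟_ {n})) using (_∈?_)

  forest : Kruskal n
  forest = kruskal id (E (G -ᴱ D))

  components : Fin n → Fin n
  components = Kruskal.label forest

  open Kruskal (kruskal components D) public

  interleaving : Interleaving tree rest D
  interleaving = kruskal-interleaving components D

  components-internal : ∀ {e} → e ∈ E G → e ∉ D → Internal components e
  components-internal e∈G e∉D = All.lookup (kruskal-internal id (E (G -ᴱ D))) (∈-ᴱ⁺ G e∈G e∉D)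

  label-internal : ∀ {e} → e ∈ E G → Internal label e
  label-internal {e} e∈G with e ∈? D
  ... | yes e∈D = All.lookup (kruskal-internal components D) e∈D
  ... | no e∉D = kruskal-coarsens components D (components-internal e∈G e∉D)

  rest-deletable : Connected G → Unique D → All (_∈ E G) D → ∀ {D'} → D' ⊆ rest → Connected (G -ᴱ D')
  rest-deletable conn uniq D⊆G {D'} D'⊆rest u v _ _ =
    classes u v (walk-preserves label-internal (conn u v ∉⊥ ∉⊥))
    where
    D'⊆D : D' ⊆ D
    D'⊆D = ⊆-trans D'⊆rest (interleaving⇒⊆ʳ interleaving)
    forest-survives : ∀ {e} → e ∈ Kruskal.tree forest → e ∈ E (G -ᴱ D')
    forest-survives e∈forest =
      let e∈G , e∉D = ∈-ᴱ⁻ G (lookup (interleaving⇒⊆ˡ (kruskal-interleaving id (E (G -ᴱ D)))) e∈forest)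
      in ∈-ᴱ⁺ G e∈G (e∉D ∘ lookup D'⊆D)
    tree-survives : ∀ {e} → e ∈ tree → e ∈ E (G -ᴱ D')
    tree-survives e∈tree =
      ∈-ᴱ⁺ G (All.lookup D⊆G (lookup (interleaving⇒⊆ˡ interleaving) e∈tree))
             (λ e∈D' → interleaving-disjoint uniq interleaving (e∈tree , lookup D'⊆rest e∈D'))
    classes : ClassesConnected (G -ᴱ D') label
    classes = kruskal-connected D (kruskal-connected (E (G -ᴱ D)) id-classes-connected forest-survives)
                                tree-survives

  rest-large : KConnected 3 G → ∀ {t} → 2 ≤ t → 3 * t ∸ 3 ≤ length D → t ≤ length rest
  rest-large κ 2≤t 3t∸3≤D =
    rest-bound 2≤t 3t∸3≤D (interleave-length interleaving) tree<roots (roots-bound κ components-internal)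
    where
    components-idempotent : IdempotentFun _≡_ components
    components-idempotent = kruskal-idempotent (E (G -ᴱ D)) (λ _ → refl)
    some-vertex : Fin n
    some-vertex = fromℕ< (≤-trans (s≤s z≤n) (proj₁ κ))
    tree<roots : length tree < roots components
    tree<roots = subst (length tree <_) (sym (kruskal-roots D components-idempotent))
      (m<m+n (length tree) (roots-positive (kruskal-idempotent D components-idempotent) some-vertex))

lemma6p17 : (t : ℕ) → 2 ≤ t → {n : ℕ} (G : Graph n) → IsSimple G → KConnected 3 G →
    (D : List (Edge n)) → Unique D → All (λ e → e ∈ E G) D → 3 * t ∸ 3 ≤ length D →
    ∃[ D' ] (D' ⊆ D × length D' ≡ t × Connected (G -ᴱ D'))
lemma6p17 t 2≤t G _ κ D uniq D⊆G 3t∸3≤D =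
  take t rest ,
  ⊆-trans (take-⊆ t rest) (interleaving⇒⊆ʳ interleaving) ,
  trans (length-take t rest) (m≤n⇒m⊓n≡m (rest-large κ 2≤t 3t∸3≤D)) ,
  rest-deletable (kconnected⇒connected κ) uniq D⊆G (take-⊆ t rest)
  where open SpanningForest G D
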